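{- Let $G$ be a finite, cubic, vertex-transitive partial cube. If some vertex of $G$ lies on two distinct 4-cycles, then $G\cong K_2\,\square\, C_{2n}$ for some $n\geq 2$.
   Context: A partial cube is a graph isomorphic to an isometric subgraph of a hypercube (a subgraph $H$ is isometric if $d_H(x,y)=d_G(x,y)$ for all $x,y\in V(H)$). $\square$ denotes the Cartesian product of graphs, $C_k$ the cycle of length $k$, $K_2$ the complete graph on two vertices. Graphs are finite and simple. -}

module Defs where

open import Data.Nat using (ℕ; zero; suc; _≤_; _≡ᵇ_; _+_)
open import Data.Bool using (Bool; true; false; T; _∧_; _∨_; if_then_else_; not)
open import Data.Fin using (Fin; toℕ)
open import Data.Fin.Properties using (_≟_)
open import Data.List using (length; filterᵇ; allFin)
open import Data.Vec using (Vec; []; _∷_)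
open import Data.Product using (Σ; _×_; _,_; proj₁)
open import Data.Sum using (_⊎_)
open import Relation.Binary.PropositionalEquality using (_≡_; _≢_)
open import Relation.Nullary using (¬_)
open import Relation.Nullary.Decidable using (⌊_⌋)
open import Function.Bundles using (_⇔_)

record Graph (V : Set) : Set where
  field adj : V → V → Bool

open Graph public

Adj : ∀ {V} → Graph V → V → V → Set
Adj G x y = T (adj G x y)

IsSimple : ∀ {V} → Graph V → Set
IsSimple {V} G = (∀ (x y : V) → adj G x y ≡ adj G y x) × (∀ (x : V) → adj G x x ≡ false)

degree : ∀ {n} → Graph (Fin n) → Fin n → ℕ
degree {n} G v = length (filterᵇ (adj G v) (allFin n))

Cubic : ∀ {n} → Graph (Fin n) → Set
Cubic {n} G = ∀ (v : Fin n) → degree G v ≡ 3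

data Walk {V : Set} (G : Graph V) : V → V → ℕ → Set where
  here : ∀ {x} → Walk G x x 0
  step : ∀ {x y z k} → Adj G x y → Walk G y z k → Walk G x z (suc k)

Dist : ∀ {V} → Graph V → V → V → ℕ → Set
Dist G x y k = Walk G x y k × (∀ m → Walk G x y m → k ≤ m)

record Iso {V W : Set} (G : Graph V) (H : Graph W) : Set where
  field
    to      : V → W
    from    : W → V
    from∘to : ∀ x → from (to x) ≡ x
    to∘from : ∀ y → to (from y) ≡ y
    adj-pres : ∀ x y → adj G x y ≡ adj H (to x) (to y)

open Iso public

VertexTransitive : ∀ {V} → Graph V → Set
VertexTransitive {V} G = ∀ (x y : V) → Σ (Iso G G) λ σ → to σ x ≡ y

hamming : ∀ {d} → Vec Bool d → Vec Bool d → ℕ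
hamming [] [] = 0
hamming (a ∷ xs) (b ∷ ys) = (if ⌊ Data.Bool._≟_ a b ⌋ then 0 else 1) + hamming xs ys

Hypercube : (d : ℕ) → Graph (Vec Bool d)
Hypercube d = record { adj = λ x y → hamming x y ≡ᵇ 1 }

Subgraph : (d : ℕ) → (S : Vec Bool d → Bool) → (E : Vec Bool d → Vec Bool d → Bool)
         → Graph (Σ (Vec Bool d) (λ x → T (S x)))
Subgraph d S E = record { adj = λ x y → E (proj₁ x) (proj₁ y) ∧ adj (Hypercube d) (proj₁ x) (proj₁ y) }

PartialCube : ∀ {V} → Graph V → Set
PartialCube G =
  Σ ℕ λ d → Σ (Vec Bool d → Bool) λ S → Σ (Vec Bool d → Vec Bool d → Bool) λ E →
    IsSimple (Subgraph d S E)
    × (∀ x y k → Dist (Subgraph d S E) x y k ⇔ Dist (Hypercube d) (proj₁ x) (proj₁ y) k)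
    × Iso G (Subgraph d S E)

record FourCycle {V : Set} (G : Graph V) : Set where
  field
    v0 v1 v2 v3 : V
    d01 : v0 ≢ v1
    d02 : v0 ≢ v2
    d03 : v0 ≢ v3
    d12 : v1 ≢ v2
    d13 : v1 ≢ v3
    d23 : v2 ≢ v3
    e01 : Adj G v0 v1
    e12 : Adj G v1 v2
    e23 : Adj G v2 v3
    e30 : Adj G v3 v0

open FourCycle public

OnCycle : ∀ {V} {G : Graph V} → V → FourCycle G → Set
OnCycle v C = v ≡ v0 C ⊎ v ≡ v1 C ⊎ v ≡ v2 C ⊎ v ≡ v3 C

UEdge : ∀ {V : Set} → V → V → V → V → Set
UEdge x y a b = (x ≡ a × y ≡ b) ⊎ (x ≡ b × y ≡ a)

CycleEdge : ∀ {V} {G : Graph V} → FourCycle G → V → V → Set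
CycleEdge C x y = UEdge x y (v0 C) (v1 C) ⊎ UEdge x y (v1 C) (v2 C)
                ⊎ UEdge x y (v2 C) (v3 C) ⊎ UEdge x y (v3 C) (v0 C)

-- two 4-cycles (as subgraphs) are distinct iff their edge sets differ
DistinctCycles : ∀ {V} {G : Graph V} → FourCycle G → FourCycle G → Set
DistinctCycles {V} C D = ¬ (∀ (x y : V) → CycleEdge C x y ⇔ CycleEdge D x y)

K2 : Graph (Fin 2)
K2 = record { adj = λ i j → not ⌊ i ≟ j ⌋ }

nextℕ : ℕ → ℕ → ℕ
nextℕ k i = if suc i ≡ᵇ k then 0 else suc i

Cycle : (k : ℕ) → Graph (Fin k)
Cycle k = record { adj = λ i j → (toℕ j ≡ᵇ nextℕ k (toℕ i)) ∨ (toℕ i ≡ᵇ nextℕ k (toℕ j)) }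

_□_ : ∀ {a b} → Graph (Fin a) → Graph (Fin b) → Graph (Fin a × Fin b)
G □ H = record { adj = λ { (a , x) (b , y) →
   (⌊ a ≟ b ⌋ ∧ adj H x y) ∨ (⌊ x ≟ y ⌋ ∧ adj G a b) } }

module Submission where

-- Fix an embedding f of G into a hypercube Q_d.  Every edge xy carries the
-- coordinate (its label) in which f x and f y differ; opposite edges of a 4-cycle
-- carry equal labels (flip-square), so G contains no K_{2,3} (no-K23).  An edge xe
-- is a hub edge if it lies on a 4-cycle with each of the two other edges at x.
--   (1) Two distinct 4-cycles through v share exactly one edge at v, and it is a
--       hub edge; by vertex-transitivity every vertex has a hub edge.
--   (2) Let i be the label of the hub edge at v.  "x has a hub edge labelled i"
--       passes along every edge, so by connectivity it holds at every vertex.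
--   (3) These i-edges (rungs) form a perfect matching x ↦ r x, an automorphism of
--       G swapping the two sides of coordinate i; the other two edges at a vertex
--       (rails) stay on its side.
--   (4) The rail walk u 0, u 1, … never turns back; its first repetition closes a
--       cycle of length k ≥ 3, which together with its rung partners covers G.
--       The parity of f alternates along the walk, so k = 2m and G ≅ K2 □ C_2m.

open import Defs
open import Data.Nat using (ℕ; zero; suc; _≤_; _<_; _*_; _+_; _≡ᵇ_; z≤n; s≤s)
open import Data.Nat.Properties
  using (≤∧≢⇒<; ≡ᵇ⇒≡; ≡⇒≡ᵇ; ≤-trans; +-mono-≤; n≤1+n; +-suc; ≤-reflexive; ≤-antisym;
         <-cmp; <-trans; <-irrefl; n<1+n; suc-injective; anyUpTo?; <-≤-trans; ≤-pred; 0≢1+n; 1+n≢0)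
open import Relation.Binary.Definitions using (tri<; tri≈; tri>)
open import Data.Bool using (Bool; true; false; T; not; _xor_)
open import Data.Bool.Properties
  using (not-involutive; not-¬; T-irrelevant; T-≡; T-∧; T-∨; ⇔→≡; not-distribʳ-xor; xor-identityʳ;
         ∧-zeroʳ; ∧-identityʳ; ∨-identityʳ)
open import Data.Fin using (Fin; toℕ; fromℕ<) renaming (zero to fz; suc to fs)
open import Data.Fin.Properties using (_≟_; toℕ-injective; toℕ-fromℕ<; toℕ<n; pigeonhole)
open import Data.Vec using (Vec; []; _∷_; lookup)
open import Data.Product using (Σ; _×_; _,_; proj₁; proj₂)
open import Data.Sum using (_⊎_; inj₁; inj₂)
import Data.Sum
open import Data.Empty using (⊥; ⊥-elim)
open import Data.Unit using (tt)
open import Relation.Binary.PropositionalEquality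
  using (_≡_; _≢_; refl; sym; trans; cong; cong₂; subst; subst₂; module ≡-Reasoning)
open import Relation.Nullary using (¬_; Dec; yes; no)
open import Relation.Nullary.Decidable using (⌊_⌋; T?; toWitness; fromWitness)
open import Function using (_∘_)
open import Function.Bundles using (_⇔_; mk⇔; Equivalence)
open import Function.Construct.Identity using (⇔-id)
open import Function.Construct.Symmetry using (⇔-sym)
open import Function.Construct.Composition using (_⇔-∘_)
open import Data.List using (List; []; _∷_; length; filterᵇ; allFin)
open import Data.List.Relation.Unary.Any using (here; there)
open import Data.List.Relation.Unary.All using ([]; _∷_)
open import Data.List.Relation.Unary.AllPairs using ([]; _∷_)
open import Data.List.Membership.Propositional using (_∈_)
open import Data.List.Membership.Propositional.Properties using (∈-filter⁺; ∈-filter⁻; ∈-allFin)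
open import Data.List.Relation.Unary.Unique.Propositional using (Unique)
open import Data.List.Relation.Unary.Unique.Propositional.Properties using (allFin⁺; filter⁺)

T-ext : ∀ {a b} → (T a ⇔ T b) → a ≡ b
T-ext {a} {b} h = ⇔→≡ {z = true} (T-≡ {b} ⇔-∘ (h ⇔-∘ ⇔-sym (T-≡ {a})))

not-no-fixpoint : ∀ b → not b ≢ b
not-no-fixpoint b e = not-¬ refl (sym e)

flip : ∀ {d} → Fin d → Vec Bool d → Vec Bool d
flip fz     (x ∷ xs) = not x ∷ xs
flip (fs p) (x ∷ xs) = x ∷ flip p xs

flip-involutive : ∀ {d} (p : Fin d) v → flip p (flip p v) ≡ v
flip-involutive fz     (x ∷ xs) = cong (_∷ xs) (not-involutive x)
flip-involutive (fs p) (x ∷ xs) = cong (x ∷_) (flip-involutive p xs)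

flip-comm : ∀ {d} (p q : Fin d) v → flip p (flip q v) ≡ flip q (flip p v)
flip-comm fz     fz     (x ∷ xs) = refl
flip-comm fz     (fs q) (x ∷ xs) = refl
flip-comm (fs p) fz     (x ∷ xs) = refl
flip-comm (fs p) (fs q) (x ∷ xs) = cong (x ∷_) (flip-comm p q xs)

flip-at : ∀ {d} (p : Fin d) v → lookup (flip p v) p ≡ not (lookup v p)
flip-at fz     (x ∷ xs) = refl
flip-at (fs p) (x ∷ xs) = flip-at p xs

flip-other : ∀ {d} (p j : Fin d) v → p ≢ j → lookup (flip p v) j ≡ lookup v j
flip-other fz     fz     (x ∷ xs) p≢j = ⊥-elim (p≢j refl)
flip-other fz     (fs j) (x ∷ xs) p≢j = refl
flip-other (fs p) fz     (x ∷ xs) p≢j = refl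
flip-other (fs p) (fs j) (x ∷ xs) p≢j = flip-other p j xs (p≢j ∘ cong fs)

flip-injectiveˡ : ∀ {d} (p q : Fin d) v → flip p v ≡ flip q v → p ≡ q
flip-injectiveˡ p q v e with p ≟ q
... | yes p≡q = p≡q
... | no  p≢q = ⊥-elim (not-no-fixpoint (lookup v p)
      (trans (sym (flip-at p v)) (trans (cong (λ w → lookup w p) e) (flip-other q p v (p≢q ∘ sym)))))

-- Four flips that close up, where the first is undone neither by the second nor
-- by the last, have the pattern p q p q: opposite sides of a square in Q_d are
-- parallel.
flip-square : ∀ {d} (p q r s : Fin d) v → flip s (flip r (flip q (flip p v))) ≡ v
            → p ≢ q → p ≢ s → r ≡ p × s ≡ q
flip-square p q r s v closed p≢q p≢s = r≡p , s≡q
  where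
  open ≡-Reasoning
  r≡p : r ≡ p
  r≡p with r ≟ p
  ... | yes e = e
  ... | no r≢p = ⊥-elim (not-no-fixpoint (lookup v p) (sym (begin
      lookup v p                                              ≡⟨ cong (λ w → lookup w p) (sym closed) ⟩
      lookup (flip s (flip r (flip q (flip p v)))) p          ≡⟨ flip-other s p _ (p≢s ∘ sym) ⟩
      lookup (flip r (flip q (flip p v))) p                   ≡⟨ flip-other r p _ r≢p ⟩
      lookup (flip q (flip p v)) p                            ≡⟨ flip-other q p _ (p≢q ∘ sym) ⟩
      lookup (flip p v) p                                     ≡⟨ flip-at p v ⟩
      not (lookup v p)                                        ∎)))
  two-flips : flip s (flip q v) ≡ v
  two-flips = begin
    flip s (flip q v)                           ≡⟨ cong (flip s) (sym (flip-involutive p _)) ⟩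
    flip s (flip p (flip p (flip q v)))         ≡⟨ cong (flip s ∘ flip p) (flip-comm p q v) ⟩
    flip s (flip p (flip q (flip p v)))         ≡⟨ cong (λ t → flip s (flip t (flip q (flip p v)))) (sym r≡p) ⟩
    flip s (flip r (flip q (flip p v)))         ≡⟨ closed ⟩
    v                                           ∎
  s≡q : s ≡ q
  s≡q = flip-injectiveˡ s q (flip q v)
          (trans two-flips (sym (flip-involutive q v)))

hamming-refl : ∀ {d} (v : Vec Bool d) → hamming v v ≡ 0
hamming-refl []          = refl
hamming-refl (false ∷ v) = hamming-refl v
hamming-refl (true ∷ v)  = hamming-refl v

hamming-0 : ∀ {d} (u v : Vec Bool d) → hamming u v ≡ 0 → v ≡ u
hamming-0 []          []          _ = refl
hamming-0 (false ∷ u) (false ∷ v) h = cong (false ∷_) (hamming-0 u v h)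
hamming-0 (true ∷ u)  (true ∷ v)  h = cong (true ∷_) (hamming-0 u v h)
hamming-0 (false ∷ u) (true ∷ v)  ()
hamming-0 (true ∷ u)  (false ∷ v) ()

hamming-1 : ∀ {d} (u v : Vec Bool d) → hamming u v ≡ 1 → Σ (Fin d) λ p → v ≡ flip p u
hamming-1 []          []          ()
hamming-1 (false ∷ u) (false ∷ v) h = let p , e = hamming-1 u v h in fs p , cong (false ∷_) e
hamming-1 (true ∷ u)  (true ∷ v)  h = let p , e = hamming-1 u v h in fs p , cong (true ∷_) e
hamming-1 (false ∷ u) (true ∷ v)  h = fz , cong (true ∷_) (hamming-0 u v (suc-injective h))
hamming-1 (true ∷ u)  (false ∷ v) h = fz , cong (false ∷_) (hamming-0 u v (suc-injective h))

parity : ∀ {d} → Vec Bool d → Bool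
parity []       = false
parity (x ∷ xs) = x xor parity xs

parity-flip : ∀ {d} (p : Fin d) v → parity (flip p v) ≡ not (parity v)
parity-flip fz     (false ∷ xs) = refl
parity-flip fz     (true ∷ xs)  = sym (not-involutive _)
parity-flip (fs p) (false ∷ xs) = parity-flip p xs
parity-flip (fs p) (true ∷ xs)  = cong not (parity-flip p xs)

liftWalk : ∀ {d} x {u v : Vec Bool d} {k} → Walk (Hypercube d) u v k
         → Walk (Hypercube (suc d)) (x ∷ u) (x ∷ v) k
liftWalk x     here       = here
liftWalk false (step a w) = step a (liftWalk false w)
liftWalk true  (step a w) = step a (liftWalk true w)

head-edge : ∀ {d} (u : Vec Bool d) → Adj (Hypercube (suc d)) (false ∷ u) (true ∷ u)
                                    × Adj (Hypercube (suc d)) (true ∷ u) (false ∷ u)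
head-edge u rewrite hamming-refl u = tt , tt

hamming-walk : ∀ {d} (u v : Vec Bool d) → Walk (Hypercube d) u v (hamming u v)
hamming-walk []          []          = here
hamming-walk (false ∷ u) (false ∷ v) = liftWalk false (hamming-walk u v)
hamming-walk (true ∷ u)  (true ∷ v)  = liftWalk true (hamming-walk u v)
hamming-walk (false ∷ u) (true ∷ v)  = step (proj₁ (head-edge u)) (liftWalk true (hamming-walk u v))
hamming-walk (true ∷ u)  (false ∷ v) = step (proj₂ (head-edge u)) (liftWalk false (hamming-walk u v))

hamming-triangle : ∀ {d} (u w v : Vec Bool d) → hamming u v ≤ hamming u w + hamming w v
hamming-triangle []          []          []          = z≤n
hamming-triangle (false ∷ u) (false ∷ w) (false ∷ v) = hamming-triangle u w v
hamming-triangle (false ∷ u) (false ∷ w) (true ∷ v)  = ≤-trans (s≤s (hamming-triangle u w v)) (≤-reflexive (sym (+-suc _ _)))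
hamming-triangle (false ∷ u) (true ∷ w)  (false ∷ v) = ≤-trans (hamming-triangle u w v) (+-mono-≤ (n≤1+n _) (n≤1+n _))
hamming-triangle (false ∷ u) (true ∷ w)  (true ∷ v)  = s≤s (hamming-triangle u w v)
hamming-triangle (true ∷ u)  (true ∷ w)  (true ∷ v)  = hamming-triangle u w v
hamming-triangle (true ∷ u)  (true ∷ w)  (false ∷ v) = ≤-trans (s≤s (hamming-triangle u w v)) (≤-reflexive (sym (+-suc _ _)))
hamming-triangle (true ∷ u)  (false ∷ w) (true ∷ v)  = ≤-trans (hamming-triangle u w v) (+-mono-≤ (n≤1+n _) (n≤1+n _))
hamming-triangle (true ∷ u)  (false ∷ w) (false ∷ v) = s≤s (hamming-triangle u w v)

hamming-≤-walk : ∀ {d} {u v : Vec Bool d} {m} → Walk (Hypercube d) u v m → hamming u v ≤ m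
hamming-≤-walk {u = u} here = ≤-reflexive (hamming-refl u)
hamming-≤-walk {u = u} {v} (step {y = w} a wk) =
  ≤-trans (hamming-triangle u w v) (+-mono-≤ (≤-reflexive (≡ᵇ⇒≡ _ 1 a)) (hamming-≤-walk wk))

hamming-dist : ∀ {d} (u v : Vec Bool d) → Dist (Hypercube d) u v (hamming u v)
hamming-dist u v = hamming-walk u v , λ m w → hamming-≤-walk w

-- What the proof uses of a partial cube: an injective map into Q_d sending edges
-- to hypercube edges, together with connectivity (inherited via isometry).

record Embedding {n} (G : Graph (Fin n)) : Set where
  field
    d           : ℕ
    f           : Fin n → Vec Bool d
    f-injective : ∀ x y → f x ≡ f y → x ≡ y
    f-edge      : ∀ x y → Adj G x y → hamming (f x) (f y) ≡ 1
    connected   : ∀ x y → Σ ℕ (Walk G x y)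

mapWalk : ∀ {V W : Set} {H : Graph W} {G : Graph V} (g : W → V)
        → (∀ a b → Adj H a b → Adj G (g a) (g b))
        → ∀ {a b k} → Walk H a b k → Walk G (g a) (g b) k
mapWalk g g-edge here       = here
mapWalk g g-edge (step a w) = step (g-edge _ _ a) (mapWalk g g-edge w)

partialCube-embedding : ∀ {n} (G : Graph (Fin n)) → PartialCube G → Embedding G
partialCube-embedding {n} G (d , S , E , _ , isometric , I) = record
  { d = d ; f = f ; f-injective = f-injective ; f-edge = f-edge ; connected = connected }
  where
  H : Graph (Σ (Vec Bool d) (λ x → T (S x)))
  H = Subgraph d S E
  f : Fin n → Vec Bool d
  f x = proj₁ (to I x)
  point-≡ : ∀ (a b : Σ (Vec Bool d) (λ x → T (S x))) → proj₁ a ≡ proj₁ b → a ≡ b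
  point-≡ (a , p) (.a , q) refl = cong (a ,_) (T-irrelevant p q)
  f-injective : ∀ x y → f x ≡ f y → x ≡ y
  f-injective x y e = trans (sym (from∘to I x)) (trans (cong (from I) (point-≡ _ _ e)) (from∘to I y))
  f-edge : ∀ x y → Adj G x y → hamming (f x) (f y) ≡ 1
  f-edge x y a = ≡ᵇ⇒≡ _ 1 (proj₂ (Equivalence.to T-∧ (subst T (adj-pres I x y) a)))
  from-edge : ∀ a b → Adj H a b → Adj G (from I a) (from I b)
  from-edge a b h = subst T (sym (trans (adj-pres I (from I a) (from I b))
                                        (cong₂ (adj H) (to∘from I a) (to∘from I b)))) h
  -- the hypercube geodesic between f x and f y is realised inside H
  connected : ∀ x y → Σ ℕ (Walk G x y)
  connected x y = hamming (f x) (f y) , back (mapWalk (from I) from-edge geodesic)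
    where
    geodesic : Walk H (to I x) (to I y) (hamming (f x) (f y))
    geodesic = proj₁ (Equivalence.from (isometric (to I x) (to I y) _) (hamming-dist (f x) (f y)))
    back : ∀ {k} → Walk G (from I (to I x)) (from I (to I y)) k → Walk G x y k
    back w rewrite from∘to I x | from∘to I y = w

least : ∀ {P : ℕ → Set} → (∀ m → Dec (P m)) → ∀ N → (Σ ℕ λ m → m < N × P m)
      → Σ ℕ λ j → P j × (∀ j' → j' < j → ¬ P j')
least P? zero    (_ , () , _)
least P? (suc N) (m , m<1+N , pm) with anyUpTo? P? N
... | yes below = least P? N below
... | no  none  = m , pm , λ j' j'<m pj' → none (j' , <-≤-trans j'<m (≤-pred m<1+N) , pj')

InjectiveBelow : ∀ {A : Set} → (ℕ → A) → ℕ → Set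
InjectiveBelow u k = ∀ a b → a < b → b < k → u a ≢ u b

first-repetition : ∀ {n} (u : ℕ → Fin n) →
  Σ ℕ λ k → Σ ℕ λ l → l < k × u l ≡ u k × InjectiveBelow u k
first-repetition {n} u with pigeonhole (n<1+n n) (u ∘ toℕ)
... | a , b , a<b , ua≡ub with least repeats? (suc (toℕ b)) (toℕ b , n<1+n _ , toℕ a , a<b , ua≡ub)
  where
  repeats? : ∀ j → Dec (Σ ℕ λ l → l < j × u l ≡ u j)
  repeats? j = anyUpTo? (λ l → u l ≟ u j) j
... | k , (l , l<k , ul≡uk) , first = k , l , l<k , ul≡uk , λ a b a<b b<k ua≡ub → first b b<k (a , a<b , ua≡ub)

next-cases : ∀ k t → (suc t ≡ k × nextℕ k t ≡ 0) ⊎ (suc t ≢ k × nextℕ k t ≡ suc t)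
next-cases k t with suc t ≡ᵇ k in eq
... | true  = inj₁ (≡ᵇ⇒≡ (suc t) k (subst T (sym eq) tt) , refl)
... | false = inj₂ ((λ e → subst T eq (≡⇒≡ᵇ (suc t) k e)) , refl)

next-< : ∀ {k t} → t < k → nextℕ k t < k
next-< {k} {t} t<k with next-cases k t
... | inj₁ (_ , e)     = subst (_< k) (sym e) (≤-trans (s≤s z≤n) t<k)
... | inj₂ (1+t≢k , e) = subst (_< k) (sym e) (≤∧≢⇒< t<k 1+t≢k)

next-predecessor : ∀ {k t} → t < k → Σ ℕ λ p → p < k × nextℕ k p ≡ t
next-predecessor {suc k'} {zero} _ with next-cases (suc k') k'
... | inj₁ (_ , e)    = k' , n<1+n k' , e
... | inj₂ (k≢k , _)  = ⊥-elim (k≢k refl)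
next-predecessor {k} {suc t} 1+t<k with next-cases k t
... | inj₁ (1+t≡k , _) = ⊥-elim (<-irrefl 1+t≡k 1+t<k)
... | inj₂ (_ , e)     = t , <-trans (n<1+n t) 1+t<k , e

odd : ℕ → Bool
odd zero    = false
odd (suc n) = not (odd n)

even-half : ∀ k → odd k ≡ false → Σ ℕ λ m → k ≡ 2 * m
even-half zero          _    = 0 , refl
even-half (suc zero)    ()
even-half (suc (suc k)) even with even-half k (trans (sym (not-involutive (odd k))) even)
... | m , k≡2m = suc m , trans (cong (suc ∘ suc) k≡2m) (cong suc (sym (+-suc m (m + 0))))

half-≥2 : ∀ {m} → 3 ≤ 2 * m → 2 ≤ m
half-≥2 {zero}        ()
half-≥2 {suc zero}    (s≤s (s≤s ()))
half-≥2 {suc (suc m)} _ = s≤s (s≤s z≤n)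

xor-fixes : ∀ a b → a xor b ≡ a → b ≡ false
xor-fixes false false _ = refl
xor-fixes true  false _ = refl
xor-fixes false true  ()
xor-fixes true  true  ()

cycle-adj : ∀ k (x y : Fin k)
          → Adj (Cycle k) x y ⇔ (toℕ y ≡ nextℕ k (toℕ x) ⊎ toℕ x ≡ nextℕ k (toℕ y))
cycle-adj k x y = mk⇔ (Data.Sum.map (≡ᵇ⇒≡ _ _) (≡ᵇ⇒≡ _ _) ∘ Equivalence.to T-∨)
                      (Equivalence.from T-∨ ∘ Data.Sum.map (≡⇒≡ᵇ _ _) (≡⇒≡ᵇ _ _))

prism-adj-layer : ∀ {k} (H : Graph (Fin k)) (a : Fin 2) x y → Adj (K2 □ H) (a , x) (a , y) ⇔ Adj H x y
prism-adj-layer H a x y with a ≟ a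
... | yes _   rewrite ∧-zeroʳ ⌊ x ≟ y ⌋ | ∨-identityʳ (adj H x y) = ⇔-id _
... | no a≢a = ⊥-elim (a≢a refl)

prism-adj-rung : ∀ {k} (H : Graph (Fin k)) {a b : Fin 2} x y → a ≢ b → Adj (K2 □ H) (a , x) (b , y) ⇔ x ≡ y
prism-adj-rung H {a} {b} x y a≢b with a ≟ b
... | yes a≡b = ⊥-elim (a≢b a≡b)
... | no _    rewrite ∧-identityʳ ⌊ x ≟ y ⌋ = mk⇔ toWitness fromWitness

iso-of-bijection : ∀ {V W : Set} (G : Graph V) (H : Graph W) (φ : V → W) (ψ : W → V)
                 → (∀ x → ψ (φ x) ≡ x) → (∀ y → φ (ψ y) ≡ y)
                 → (∀ p q → Adj G (ψ p) (ψ q) ⇔ Adj H p q) → Iso G H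
iso-of-bijection G H φ ψ ψφ φψ ψ-adj = record
  { to = φ ; from = ψ ; from∘to = ψφ ; to∘from = φψ
  ; adj-pres = λ x y → trans (cong₂ (adj G) (sym (ψφ x)) (sym (ψφ y))) (T-ext (ψ-adj (φ x) (φ y))) }

module Neighbourhoods {n} (G : Graph (Fin n)) (cubic : Cubic G) where

  Among : Fin n → Fin n → Fin n → Fin n → Set
  Among x a b c = ∀ y → Adj G x y → y ≡ a ⊎ y ≡ b ⊎ y ≡ c

  record Neighbours (x : Fin n) : Set where
    field
      a b c    : Fin n
      xa       : Adj G x a
      xb       : Adj G x b
      xc       : Adj G x c
      a≢b      : a ≢ b
      a≢c      : a ≢ c
      b≢c      : b ≢ c
      among    : Among x a b c

  neighbours : ∀ x → Neighbours x
  neighbours x = from-list (filterᵇ (adj G x) (allFin n)) (cubic x)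
                   (filter⁺ (T? ∘ adj G x) (allFin⁺ n)) member adjacent
    where
    member : ∀ y → Adj G x y → y ∈ filterᵇ (adj G x) (allFin n)
    member y h = ∈-filter⁺ (T? ∘ adj G x) (∈-allFin y) h
    adjacent : ∀ {y} → y ∈ filterᵇ (adj G x) (allFin n) → Adj G x y
    adjacent h = proj₂ (∈-filter⁻ (T? ∘ adj G x) {xs = allFin n} h)
    from-list : (xs : List (Fin n)) → length xs ≡ 3 → Unique xs
              → (∀ y → Adj G x y → y ∈ xs) → (∀ {y} → y ∈ xs → Adj G x y) → Neighbours x
    from-list (a ∷ b ∷ c ∷ []) refl ((a≢b ∷ a≢c ∷ []) ∷ (b≢c ∷ []) ∷ [] ∷ []) complete sound = record
      { a = a ; b = b ; c = c
      ; xa = sound (here refl) ; xb = sound (there (here refl)) ; xc = sound (there (there (here refl)))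
      ; a≢b = a≢b ; a≢c = a≢c ; b≢c = b≢c ; among = among }
      where
      among : Among x a b c
      among y h with complete y h
      ... | here e                 = inj₁ e
      ... | there (here e)         = inj₂ (inj₁ e)
      ... | there (there (here e)) = inj₂ (inj₂ e)

  among-swap₁₂ : ∀ {x a b c} → Among x a b c → Among x b a c
  among-swap₁₂ m y h with m y h
  ... | inj₁ e        = inj₂ (inj₁ e)
  ... | inj₂ (inj₁ e) = inj₁ e
  ... | inj₂ (inj₂ e) = inj₂ (inj₂ e)

  among-swap₂₃ : ∀ {x a b c} → Among x a b c → Among x a c b
  among-swap₂₃ m y h with m y h
  ... | inj₁ e        = inj₁ e
  ... | inj₂ (inj₁ e) = inj₂ (inj₂ e)
  ... | inj₂ (inj₂ e) = inj₂ (inj₁ e)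

  others : ∀ {x e} → Adj G x e → Σ (Fin n) λ a → Σ (Fin n) λ b →
           Adj G x a × Adj G x b × a ≢ b × a ≢ e × b ≢ e × Among x e a b
  others {x} {e} xe with neighbours x
  ... | N with Neighbours.among N e xe
  ... | inj₁ refl        = b , c , xb , xc , b≢c , a≢b ∘ sym , a≢c ∘ sym , among
    where open Neighbours N
  ... | inj₂ (inj₁ refl) = a , c , xa , xc , a≢c , a≢b , b≢c ∘ sym , among-swap₁₂ among
    where open Neighbours N
  ... | inj₂ (inj₂ refl) = a , b , xa , xb , a≢b , a≢c , b≢c , among-swap₁₂ (among-swap₂₃ among)
    where open Neighbours N

  third : ∀ {x a b} → Adj G x a → Adj G x b → a ≢ b →
          Σ (Fin n) λ t → Adj G x t × t ≢ a × t ≢ b × Among x a b t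
  third {x} {a} {b} xa xb a≢b with others xa
  ... | p , q , xp , xq , p≢q , p≢a , q≢a , among with among b xb
  ... | inj₁ b≡a         = ⊥-elim (a≢b (sym b≡a))
  ... | inj₂ (inj₁ refl) = q , xq , q≢a , p≢q ∘ sym , among
  ... | inj₂ (inj₂ refl) = p , xp , p≢a , p≢q , among-swap₂₃ among

  exhaust : ∀ {x a b c} → Adj G x a → Adj G x b → Adj G x c → a ≢ b → a ≢ c → b ≢ c → Among x a b c
  exhaust xa xb xc a≢b a≢c b≢c with third xa xb a≢b
  ... | t , xt , t≢a , t≢b , among with among _ xc
  ... | inj₁ c≡a         = ⊥-elim (a≢c (sym c≡a))
  ... | inj₂ (inj₁ c≡b)  = ⊥-elim (b≢c (sym c≡b))
  ... | inj₂ (inj₂ refl) = among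

-- Local square structure of a cubic graph.  Two edges xa, xb lie on a common
-- 4-cycle through x when a and b have a common neighbour other than x.
module Squares {n} (G : Graph (Fin n)) (cubic : Cubic G) where
  open Neighbourhoods G cubic public

  CoSquare : Fin n → Fin n → Fin n → Set
  CoSquare x a b = Σ (Fin n) λ c → c ≢ x × Adj G a c × Adj G b c

  cosquare-sym : ∀ {x a b} → CoSquare x a b → CoSquare x b a
  cosquare-sym (c , c≢x , ac , bc) = c , c≢x , bc , ac

  HubEdge : Fin n → Fin n → Set
  HubEdge x e = Adj G x e × (∀ y → Adj G x y → y ≢ e → CoSquare x e y)

  Hub : Fin n → Set
  Hub x = Σ (Fin n) (HubEdge x)

  AllCoSquare : Fin n → Set
  AllCoSquare x = ∀ a b → Adj G x a → Adj G x b → a ≢ b → CoSquare x a b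

  hub-of-two : ∀ {x e p q} → Adj G x e → Adj G x p → Adj G x q → e ≢ p → e ≢ q → p ≢ q
             → CoSquare x e p → CoSquare x e q → Hub x
  hub-of-two {x} {e} {p} {q} xe xp xq e≢p e≢q p≢q ep eq = e , xe , cosquares
    where
    cosquares : ∀ y → Adj G x y → y ≢ e → CoSquare x e y
    cosquares y xy y≢e with exhaust xe xp xq e≢p e≢q p≢q y xy
    ... | inj₁ y≡e         = ⊥-elim (y≢e y≡e)
    ... | inj₂ (inj₁ refl) = ep
    ... | inj₂ (inj₂ refl) = eq

  allCoSquare-of-three : ∀ {x e y z} → Adj G x e → Adj G x y → Adj G x z → e ≢ y → e ≢ z → y ≢ z
                       → CoSquare x e y → CoSquare x e z → CoSquare x y z → AllCoSquare x
  allCoSquare-of-three xe xy xz e≢y e≢z y≢z ey ez yz a b xa xb a≢b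
    with exhaust xe xy xz e≢y e≢z y≢z a xa | exhaust xe xy xz e≢y e≢z y≢z b xb
  ... | inj₁ refl        | inj₁ refl        = ⊥-elim (a≢b refl)
  ... | inj₁ refl        | inj₂ (inj₁ refl) = ey
  ... | inj₁ refl        | inj₂ (inj₂ refl) = ez
  ... | inj₂ (inj₁ refl) | inj₁ refl        = cosquare-sym ey
  ... | inj₂ (inj₁ refl) | inj₂ (inj₁ refl) = ⊥-elim (a≢b refl)
  ... | inj₂ (inj₁ refl) | inj₂ (inj₂ refl) = yz
  ... | inj₂ (inj₂ refl) | inj₁ refl        = cosquare-sym ez
  ... | inj₂ (inj₂ refl) | inj₂ (inj₁ refl) = cosquare-sym yz
  ... | inj₂ (inj₂ refl) | inj₂ (inj₂ refl) = ⊥-elim (a≢b refl)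

  -- both properties are invariant under automorphisms, hence under vertex-transitivity
  -- they hold everywhere once they hold somewhere
  module Automorphism (σ : Iso G G) where
    s : Fin n → Fin n
    s = to σ

    s-adj : ∀ {x y} → Adj G x y → Adj G (s x) (s y)
    s-adj {x} {y} = subst T (adj-pres σ x y)

    s-adj⁻ : ∀ {x y} → Adj G (s x) (s y) → Adj G x y
    s-adj⁻ {x} {y} = subst T (sym (adj-pres σ x y))

    s-injective : ∀ {x y} → s x ≡ s y → x ≡ y
    s-injective {x} {y} e = trans (sym (from∘to σ x)) (trans (cong (from σ) e) (from∘to σ y))

    pull : ∀ {x y} → Adj G (s x) y → Adj G x (from σ y)
    pull {x} {y} h = s-adj⁻ (subst (Adj G (s x)) (sym (to∘from σ y)) h)

    s-cosquare : ∀ {x a b} → CoSquare x a b → CoSquare (s x) (s a) (s b)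
    s-cosquare (c , c≢x , ac , bc) = s c , c≢x ∘ s-injective , s-adj ac , s-adj bc

    s-hub : ∀ {x} → Hub x → Hub (s x)
    s-hub {x} (e , xe , cosquares) = s e , s-adj xe , λ y sxy y≢se →
      subst (CoSquare (s x) (s e)) (to∘from σ y)
        (s-cosquare (cosquares (from σ y) (pull sxy) (λ z → y≢se (trans (sym (to∘from σ y)) (cong s z)))))

    s-allCoSquare : ∀ {x} → AllCoSquare x → AllCoSquare (s x)
    s-allCoSquare {x} all a b sxa sxb a≢b = subst₂ (CoSquare (s x)) (to∘from σ a) (to∘from σ b)
      (s-cosquare (all (from σ a) (from σ b) (pull sxa) (pull sxb)
        (λ z → a≢b (trans (sym (to∘from σ a)) (trans (cong s z) (to∘from σ b))))))

  transport-hub : VertexTransitive G → ∀ {v} → Hub v → ∀ z → Hub z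
  transport-hub vt {v} hub z = subst Hub (proj₂ (vt v z)) (Automorphism.s-hub (proj₁ (vt v z)) hub)

  transport-allCoSquare : VertexTransitive G → ∀ {v} → AllCoSquare v → ∀ z → AllCoSquare z
  transport-allCoSquare vt {v} all z =
    subst AllCoSquare (proj₂ (vt v z)) (Automorphism.s-allCoSquare (proj₁ (vt v z)) all)

module Labels {n} (G : Graph (Fin n)) (simple : IsSimple G) (emb : Embedding G) where
  open Embedding emb public

  adj-sym : ∀ {x y} → Adj G x y → Adj G y x
  adj-sym {x} {y} = subst T (proj₁ simple x y)

  adj-irrefl : ∀ {x y} → Adj G x y → x ≢ y
  adj-irrefl {x} h refl = subst T (proj₂ simple x) h

  Label : Fin n → Fin n → Fin d → Set
  Label x y p = f y ≡ flip p (f x)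

  label : ∀ {x y} → Adj G x y → Σ (Fin d) (Label x y)
  label {x} {y} h = hamming-1 (f x) (f y) (f-edge x y h)

  label-sym : ∀ {x y p} → Label x y p → Label y x p
  label-sym {x} {y} {p} e = sym (trans (cong (flip p) e) (flip-involutive p (f x)))

  label-end-unique : ∀ {x y z p} → Label x y p → Label x z p → y ≡ z
  label-end-unique e₁ e₂ = f-injective _ _ (trans e₁ (sym e₂))

  label-unique : ∀ {x y p q} → Label x y p → Label x y q → p ≡ q
  label-unique {x} {p = p} {q} e₁ e₂ = flip-injectiveˡ p q (f x) (trans (sym e₁) e₂)

  square-labels : ∀ {x a c b p q} → Label x a p → Label a c q → Adj G c b → Adj G b x
                → x ≢ c → a ≢ b → Label b c p × Label x b q
  square-labels {x} {a} {c} {b} {p} {q} xa ac cb bx x≢c a≢b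
    with label cb | label bx
  ... | r , cb-r | s , bx-s = subst (Label b c) r≡p (label-sym cb-r) , subst (Label x b) s≡q (label-sym bx-s)
    where
    open ≡-Reasoning
    closed : flip s (flip r (flip q (flip p (f x)))) ≡ f x
    closed = sym (begin
      f x                                   ≡⟨ bx-s ⟩
      flip s (f b)                          ≡⟨ cong (flip s) cb-r ⟩
      flip s (flip r (f c))                 ≡⟨ cong (flip s ∘ flip r) ac ⟩
      flip s (flip r (flip q (f a)))        ≡⟨ cong (flip s ∘ flip r ∘ flip q) xa ⟩
      flip s (flip r (flip q (flip p (f x)))) ∎)
    p≢q : p ≢ q
    p≢q refl = x≢c (f-injective _ _ (sym (trans (trans ac (cong (flip p) xa)) (flip-involutive p (f x)))))
    p≢s : p ≢ s
    p≢s refl = a≢b (label-end-unique xa (label-sym bx-s))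
    r≡p : r ≡ p
    r≡p = proj₁ (flip-square p q r s (f x) closed p≢q p≢s)
    s≡q : s ≡ q
    s≡q = proj₂ (flip-square p q r s (f x) closed p≢q p≢s)

  no-K23 : ∀ {v a b c c'} → Adj G v a → Adj G v b → a ≢ b
         → Adj G a c → Adj G b c → c ≢ v → Adj G a c' → Adj G b c' → c' ≢ v → c ≡ c'
  no-K23 va vb a≢b ac bc c≢v ac' bc' c'≢v with label va | label ac | label ac'
  ... | p , va-p | q , ac-q | q' , ac'-q' = label-end-unique ac-q (subst (Label _ _) (sym q≡q') ac'-q')
    where
    q≡q' : q ≡ q'
    q≡q' = label-unique (proj₂ (square-labels va-p ac-q  (adj-sym bc)  (adj-sym vb) (c≢v ∘ sym)  a≢b))
                        (proj₂ (square-labels va-p ac'-q' (adj-sym bc') (adj-sym vb) (c'≢v ∘ sym) a≢b))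

module Prism {n} (G : Graph (Fin n)) (simple : IsSimple G) (cubic : Cubic G) (emb : Embedding G) where
  open Squares G cubic public
  open Labels G simple emb public

  SquareEdge : Fin n → Fin n → Fin n → Fin n → Fin n → Fin n → Set
  SquareEdge x y v a c b = UEdge x y v a ⊎ UEdge x y a c ⊎ UEdge x y c b ⊎ UEdge x y b v

  record SquareAt (v : Fin n) (E : Fin n → Fin n → Set) : Set where
    constructor square
    field
      a c b : Fin n
      va    : Adj G v a
      vb    : Adj G v b
      ac    : Adj G a c
      bc    : Adj G b c
      a≢b   : a ≢ b
      c≢v   : c ≢ v
      edges : ∀ x y → E x y ⇔ SquareEdge x y v a c b

  ⊎-rotate : ∀ {P Q R S : Set} → (P ⊎ Q ⊎ R ⊎ S) ⇔ (Q ⊎ R ⊎ S ⊎ P)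
  ⊎-rotate = mk⇔ forth back
    where
    forth : ∀ {P Q R S : Set} → (P ⊎ Q ⊎ R ⊎ S) → (Q ⊎ R ⊎ S ⊎ P)
    forth (inj₁ p)                = inj₂ (inj₂ (inj₂ p))
    forth (inj₂ (inj₁ q))         = inj₁ q
    forth (inj₂ (inj₂ (inj₁ r)))  = inj₂ (inj₁ r)
    forth (inj₂ (inj₂ (inj₂ s)))  = inj₂ (inj₂ (inj₁ s))
    back : ∀ {P Q R S : Set} → (Q ⊎ R ⊎ S ⊎ P) → (P ⊎ Q ⊎ R ⊎ S)
    back (inj₁ q)                 = inj₂ (inj₁ q)
    back (inj₂ (inj₁ r))          = inj₂ (inj₂ (inj₁ r))
    back (inj₂ (inj₂ (inj₁ s)))   = inj₂ (inj₂ (inj₂ s))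
    back (inj₂ (inj₂ (inj₂ p)))   = inj₁ p

  fourCycle-at : ∀ {v} (C : FourCycle G) → OnCycle v C → SquareAt v (CycleEdge C)
  fourCycle-at C (inj₁ refl) =
    square (v1 C) (v2 C) (v3 C) (e01 C) (adj-sym (e30 C)) (e12 C) (adj-sym (e23 C))
           (d13 C) (d02 C ∘ sym) (λ x y → ⇔-id _)
  fourCycle-at C (inj₂ (inj₁ refl)) =
    square (v2 C) (v3 C) (v0 C) (e12 C) (adj-sym (e01 C)) (e23 C) (adj-sym (e30 C))
           (d02 C ∘ sym) (d13 C ∘ sym) (λ x y → ⊎-rotate)
  fourCycle-at C (inj₂ (inj₂ (inj₁ refl))) =
    square (v3 C) (v0 C) (v1 C) (e23 C) (adj-sym (e12 C)) (e30 C) (adj-sym (e01 C))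
           (d13 C ∘ sym) (d02 C) (λ x y → ⊎-rotate ⇔-∘ ⊎-rotate)
  fourCycle-at C (inj₂ (inj₂ (inj₂ refl))) =
    square (v0 C) (v1 C) (v2 C) (e30 C) (adj-sym (e23 C)) (e01 C) (adj-sym (e12 C))
           (d02 C) (d13 C) (λ x y → ⊎-rotate ⇔-∘ (⊎-rotate ⇔-∘ ⊎-rotate))

  squareEdge-reverse : ∀ {x y v a c b} → SquareEdge x y v a c b ⇔ SquareEdge x y v b c a
  squareEdge-reverse = mk⇔ reverse reverse
    where
    uswap : ∀ {x y a b : Fin n} → UEdge x y a b → UEdge x y b a
    uswap (inj₁ e) = inj₂ e
    uswap (inj₂ e) = inj₁ e
    reverse : ∀ {x y v a c b} → SquareEdge x y v a c b → SquareEdge x y v b c a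
    reverse (inj₁ e)               = inj₂ (inj₂ (inj₂ (uswap e)))
    reverse (inj₂ (inj₁ e))        = inj₂ (inj₂ (inj₁ (uswap e)))
    reverse (inj₂ (inj₂ (inj₁ e))) = inj₂ (inj₁ (uswap e))
    reverse (inj₂ (inj₂ (inj₂ e))) = inj₁ (uswap e)

  -- Two distinct 4-cycles through v cannot use the same two edges at v (no K_{2,3}),
  -- so they share exactly one edge at v, and that edge is a hub edge.
  distinct-squares-hub : ∀ {v E E'} → SquareAt v E → SquareAt v E' → ¬ (∀ x y → E x y ⇔ E' x y) → Hub v
  distinct-squares-hub {v} {E} {E'} (square a c b va vb ac bc a≢b c≢v edges)
                                    (square a' c' b' va' vb' ac' bc' a'≢b' c'≢v edges') distinct
    with third va vb a≢b
  ... | t , vt , t≢a , t≢b , among with among a' va' | among b' vb'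
  ... | inj₁ refl        | inj₁ refl        = ⊥-elim (a'≢b' refl)
  ... | inj₂ (inj₁ refl) | inj₂ (inj₁ refl) = ⊥-elim (a'≢b' refl)
  ... | inj₂ (inj₂ refl) | inj₂ (inj₂ refl) = ⊥-elim (a'≢b' refl)
  ... | inj₁ refl        | inj₂ (inj₁ refl) = ⊥-elim (distinct λ x y →
          ⇔-sym (edges' x y) ⇔-∘ subst (λ z → E x y ⇔ SquareEdge x y v a z b)
            (no-K23 va vb a≢b ac bc c≢v ac' bc' c'≢v) (edges x y))
  ... | inj₂ (inj₁ refl) | inj₁ refl        = ⊥-elim (distinct λ x y →
          ⇔-sym (edges' x y) ⇔-∘ subst (λ z → E x y ⇔ SquareEdge x y v b z a)
            (no-K23 va vb a≢b ac bc c≢v bc' ac' c'≢v) (squareEdge-reverse ⇔-∘ edges x y))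
  ... | inj₁ refl        | inj₂ (inj₂ refl) =
          hub-of-two va vb vt a≢b (t≢a ∘ sym) (t≢b ∘ sym) (c , c≢v , ac , bc) (c' , c'≢v , ac' , bc')
  ... | inj₂ (inj₂ refl) | inj₁ refl        =
          hub-of-two va vb vt a≢b (t≢a ∘ sym) (t≢b ∘ sym) (c , c≢v , ac , bc) (c' , c'≢v , bc' , ac')
  ... | inj₂ (inj₁ refl) | inj₂ (inj₂ refl) =
          hub-of-two vb va vt (a≢b ∘ sym) (t≢b ∘ sym) (t≢a ∘ sym) (c , c≢v , bc , ac) (c' , c'≢v , ac' , bc')
  ... | inj₂ (inj₂ refl) | inj₂ (inj₁ refl) =
          hub-of-two vb va vt (a≢b ∘ sym) (t≢b ∘ sym) (t≢a ∘ sym) (c , c≢v , bc , ac) (c' , c'≢v , bc' , ac')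

  HubRung : Fin d → Fin n → Set
  HubRung i x = Σ (Fin n) λ e → Label x e i × HubEdge x e

  module Propagation (hub-everywhere : ∀ z → Hub z)
                     (allCoSquare-spreads : ∀ {x} → AllCoSquare x → ∀ z → AllCoSquare z)
                     (i : Fin d) where

    record Corner (x e y : Fin n) : Set where
      field
        c      : Fin n
        c≢x    : c ≢ x
        ec     : Adj G e c
        yc     : Adj G y c
        yc-i   : Label y c i
        q      : Fin d
        ec-q   : Label e c q
        xy-q   : Label x y q

    corner : ∀ {x e y} → Label x e i → HubEdge x e → Adj G x y → y ≢ e → Corner x e y
    corner xe-i (xe , cosquares) xy y≢e with cosquares _ xy y≢e
    ... | c , c≢x , ec , yc with label ec
    ... | q , ec-q with square-labels xe-i ec-q (adj-sym yc) (adj-sym xy) (c≢x ∘ sym) (y≢e ∘ sym)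
    ... | yc-i , xy-q = record { c = c ; c≢x = c≢x ; ec = ec ; yc = yc ; yc-i = yc-i
                               ; q = q ; ec-q = ec-q ; xy-q = xy-q }

    corners-among : ∀ {x e y z} → Adj G x e → Adj G x y → y ≢ z
                  → (C : Corner x e y) (D : Corner x e z) → Among e x (Corner.c C) (Corner.c D)
    corners-among xe xy y≢z C D =
      exhaust (adj-sym xe) (Corner.ec C) (Corner.ec D) (Corner.c≢x C ∘ sym) (Corner.c≢x D ∘ sym) distinct
      where
      distinct : Corner.c C ≢ Corner.c D
      distinct refl = y≢z (label-end-unique (Corner.xy-q C)
                             (subst (Label _ _) (label-unique (Corner.ec-q D) (Corner.ec-q C)) (Corner.xy-q D)))

    across-rung : ∀ {x e} → Label x e i → HubEdge x e → HubRung i e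
    across-rung {x} {e} xe-i hub@(xe , _) with others xe
    ... | y , z , xy , xz , y≢z , y≢e , z≢e , _ = x , label-sym xe-i , adj-sym xe , cosquares
      where
      C : Corner x e y
      C = corner xe-i hub xy y≢e
      D : Corner x e z
      D = corner xe-i hub xz z≢e
      cosquares : ∀ w → Adj G e w → w ≢ x → CoSquare e x w
      cosquares w ew w≢x with corners-among xe xy y≢z C D w ew
      ... | inj₁ w≡x         = ⊥-elim (w≢x w≡x)
      ... | inj₂ (inj₁ refl) = y , y≢e , xy , adj-sym (Corner.yc C)
      ... | inj₂ (inj₂ refl) = z , z≢e , xz , adj-sym (Corner.yc D)

    -- a rail neighbour y of x is not adjacent to the corner of the square on another
    -- rail xz: the square y x e c would make xy parallel to ec, hence to xz
    far-corner : ∀ {x e y z} → Label x e i → Adj G x y → y ≢ e → y ≢ z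
               → (D : Corner x e z) → ¬ Adj G y (Corner.c D)
    far-corner {e = e} xe-i xy y≢e y≢z D y-cD with label (adj-sym xy)
    ... | p , yx-p = y≢z (label-end-unique (label-sym yx-p) (subst (Label _ _) (sym p≡q) (Corner.xy-q D)))
      where
      parallel : Label (Corner.c D) e p
      parallel = proj₁ (square-labels yx-p xe-i (Corner.ec D) (adj-sym y-cD) y≢e (Corner.c≢x D ∘ sym))
      p≡q : p ≡ Corner.q D
      p≡q = label-unique (label-sym parallel) (Corner.ec-q D)

    -- with yc the i-edge at the rail neighbour y and t its third neighbour, the
    -- edges yc, yt lie on a common square.  If the hub edge at y is yc or yt this is
    -- immediate; if it is yx, the square through yx, yt closes at the third
    -- neighbour z of x (closing at e is excluded by far-corner), so every pair of
    -- edges at x lies on a square, and by vertex-transitivity the same holds at y.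
    third-cosquare : ∀ {x e y} → Label x e i → (hub : HubEdge x e) → Adj G x y → y ≢ e → (C : Corner x e y)
                   → ∀ {t} → Adj G y t → t ≢ x → t ≢ Corner.c C → CoSquare y (Corner.c C) t
    third-cosquare {x} {e} {y} xe-i hub@(xe , cosquares) xy y≢e C {t} yt t≢x t≢c
      with hub-everywhere y
    ... | h , yh , cosquares-y
      with exhaust (adj-sym xy) (Corner.yc C) yt (Corner.c≢x C ∘ sym) (t≢x ∘ sym) (t≢c ∘ sym) h yh
    ... | inj₂ (inj₁ refl) = cosquares-y t yt t≢c
    ... | inj₂ (inj₂ refl) = cosquare-sym (cosquares-y (Corner.c C) (Corner.yc C) (t≢c ∘ sym))
    ... | inj₁ refl with cosquares-y t yt t≢x
    ... | w , w≢y , xw , tw with third xe xy (y≢e ∘ sym)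
    ... | z , xz , z≢e , z≢y , among-x with among-x w xw
    ... | inj₂ (inj₁ w≡y)  = ⊥-elim (w≢y w≡y)
    ... | inj₂ (inj₂ refl) =
          allCoSquare-spreads
            (allCoSquare-of-three xe xy xz (y≢e ∘ sym) (z≢e ∘ sym) (z≢y ∘ sym)
               (cosquares y xy y≢e) (cosquares z xz z≢e) (t , t≢x , yt , adj-sym tw))
            y (Corner.c C) t (Corner.yc C) yt (t≢c ∘ sym)
    ... | inj₁ refl with corners-among xe xy (z≢y ∘ sym) C (corner xe-i hub xz z≢e) t (adj-sym tw)
    ... | inj₁ t≡x         = ⊥-elim (t≢x t≡x)
    ... | inj₂ (inj₁ t≡c)  = ⊥-elim (t≢c t≡c)
    ... | inj₂ (inj₂ refl) = ⊥-elim (far-corner xe-i xy y≢e (z≢y ∘ sym) (corner xe-i hub xz z≢e) yt)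

    along-rail : ∀ {x e y} → Label x e i → HubEdge x e → Adj G x y → y ≢ e → HubRung i y
    along-rail {x} {e} {y} xe-i hub xy y≢e = c , yc-i , yc , cosquares
      where
      C : Corner x e y
      C = corner xe-i hub xy y≢e
      open Corner C
      cosquares : ∀ w → Adj G y w → w ≢ c → CoSquare y c w
      cosquares w yw w≢c with third (adj-sym xy) yc (c≢x ∘ sym)
      ... | t , yt , t≢x , t≢c , among-y with among-y w yw
      ... | inj₁ refl        = e , y≢e ∘ sym , adj-sym ec , proj₁ hub
      ... | inj₂ (inj₁ w≡c)  = ⊥-elim (w≢c w≡c)
      ... | inj₂ (inj₂ refl) = third-cosquare xe-i hub xy y≢e C yt t≢x t≢c

    hubRung-step : ∀ {x y} → HubRung i x → Adj G x y → HubRung i y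
    hubRung-step {y = y} (e , xe-i , hub) xy with y ≟ e
    ... | yes refl = across-rung xe-i hub
    ... | no y≢e   = along-rail xe-i hub xy y≢e

    hubRung-walk : ∀ {x y k} → Walk G x y k → HubRung i x → HubRung i y
    hubRung-walk here         h = h
    hubRung-walk (step xy w)  h = hubRung-walk w (hubRung-step h xy)

    hubRung-everywhere : ∀ {v} → HubRung i v → ∀ y → HubRung i y
    hubRung-everywhere {v} h y = hubRung-walk (proj₂ (connected v y)) h

  module Rungs (i : Fin d) (rungs : ∀ x → HubRung i x) where

    r : Fin n → Fin n
    r x = proj₁ (rungs x)

    r-label : ∀ {x} → Label x (r x) i
    r-label {x} = proj₁ (proj₂ (rungs x))

    r-hub : ∀ {x} → HubEdge x (r x)
    r-hub {x} = proj₂ (proj₂ (rungs x))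

    r-adj : ∀ {x} → Adj G x (r x)
    r-adj = proj₁ r-hub

    r-unique : ∀ {x y} → Label x y i → y ≡ r x
    r-unique e = label-end-unique e r-label

    r-involutive : ∀ {x} → r (r x) ≡ x
    r-involutive = sym (r-unique (label-sym r-label))

    not-rung-sym : ∀ {x y} → y ≢ r x → x ≢ r y
    not-rung-sym y≢rx x≡ry = y≢rx (trans (sym r-involutive) (cong r (sym x≡ry)))

    -- a rail xy is carried to the rail between the rung partners (the hub squares)
    r-rail : ∀ {x y} → Adj G x y → y ≢ r x → Adj G (r x) (r y)
    r-rail {x} xy y≢rx with proj₂ r-hub _ xy y≢rx
    ... | c , c≢x , rx-c , yc with label rx-c
    ... | q , rx-c-q with square-labels r-label rx-c-q (adj-sym yc) (adj-sym xy) (c≢x ∘ sym) (y≢rx ∘ sym)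
    ... | yc-i , _ = subst (Adj G (r x)) (r-unique yc-i) rx-c

    r-automorphism : ∀ {x y} → Adj G x y → Adj G (r x) (r y)
    r-automorphism {x} {y} xy with y ≟ r x
    ... | yes refl = subst (Adj G (r x)) (sym r-involutive) (adj-sym r-adj)
    ... | no y≢rx  = r-rail xy y≢rx

    r-automorphism⁻ : ∀ {x y} → Adj G (r x) (r y) → Adj G x y
    r-automorphism⁻ h = subst₂ (Adj G) r-involutive r-involutive (r-automorphism h)

    side : Fin n → Bool
    side x = lookup (f x) i

    side-r : ∀ {x} → side (r x) ≡ not (side x)
    side-r {x} = trans (cong (λ w → lookup w i) r-label) (flip-at i (f x))

    side-rail : ∀ {x y} → Adj G x y → y ≢ r x → side y ≡ side x
    side-rail {x} xy y≢rx with label xy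
    ... | p , xy-p with p ≟ i
    ... | yes refl = ⊥-elim (y≢rx (r-unique xy-p))
    ... | no p≢i   = trans (cong (λ w → lookup w i) xy-p) (flip-other p i (f x) p≢i)

    side-change : ∀ {x y} → Adj G x y → side y ≢ side x → y ≡ r x
    side-change {x} {y} xy change with y ≟ r x
    ... | yes y≡rx = y≡rx
    ... | no y≢rx  = ⊥-elim (change (side-rail xy y≢rx))

    rails-among : ∀ {x p q y} → Adj G x p → p ≢ r x → Adj G x q → q ≢ r x → p ≢ q
                → Adj G x y → y ≢ r x → y ≡ p ⊎ y ≡ q
    rails-among xp p≢rx xq q≢rx p≢q xy y≢rx
      with exhaust r-adj xp xq (p≢rx ∘ sym) (q≢rx ∘ sym) p≢q _ xy
    ... | inj₁ y≡rx = ⊥-elim (y≢rx y≡rx)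
    ... | inj₂ rail = rail

    record RailStep : Set where
      field
        src tgt : Fin n
        edge    : Adj G src tgt
        rail    : tgt ≢ r src

    first-rail : Fin n → RailStep
    first-rail x with others (r-adj {x})
    ... | a , _ , xa , _ , _ , a≢rx , _ , _ = record { src = x ; tgt = a ; edge = xa ; rail = a≢rx }

    other-rail : ∀ x p → Σ (Fin n) λ q → Adj G x q × q ≢ r x × q ≢ p
    other-rail x p with others (r-adj {x})
    ... | a , b , xa , xb , a≢b , a≢rx , b≢rx , _ with a ≟ p
    ... | yes refl = b , xb , b≢rx , a≢b ∘ sym
    ... | no  a≢p  = a , xa , a≢rx , a≢p

    continue : RailStep → RailStep
    continue s = record { src = tgt ; tgt = q ; edge = tq ; rail = q≢rt }
      where
      open RailStep s
      q : Fin n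
      q = proj₁ (other-rail tgt src)
      tq : Adj G tgt q
      tq = proj₁ (proj₂ (other-rail tgt src))
      q≢rt : q ≢ r tgt
      q≢rt = proj₁ (proj₂ (proj₂ (other-rail tgt src)))

    continue-turns : ∀ s → RailStep.tgt (continue s) ≢ RailStep.src s
    continue-turns s = proj₂ (proj₂ (proj₂ (other-rail (RailStep.tgt s) (RailStep.src s))))

    r-injective : ∀ {x y} → r x ≡ r y → x ≡ y
    r-injective e = trans (sym r-involutive) (trans (cong r e) r-involutive)

    module RailWalk (u0 : Fin n) where

      walk : ℕ → RailStep
      walk zero    = first-rail u0
      walk (suc j) = continue (walk j)

      u : ℕ → Fin n
      u j = RailStep.src (walk j)

      u-edge : ∀ j → Adj G (u j) (u (suc j))
      u-edge j = RailStep.edge (walk j)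

      u-rail : ∀ j → u (suc j) ≢ r (u j)
      u-rail j = RailStep.rail (walk j)

      u-turns : ∀ j → u (suc (suc j)) ≢ u j
      u-turns j = continue-turns (walk j)

      u-side : ∀ j → side (u j) ≡ side u0
      u-side zero    = refl
      u-side (suc j) = trans (side-rail (u-edge j) (u-rail j)) (u-side j)

      rung-off-walk : ∀ a b → r (u a) ≢ u b
      rung-off-walk a b e = not-no-fixpoint (side (u a))
        (trans (sym side-r) (trans (cong side e) (trans (u-side b) (sym (u-side a)))))

      u-parity : ∀ j → parity (f (u j)) ≡ parity (f u0) xor odd j
      u-parity zero = sym (xor-identityʳ (parity (f u0)))
      u-parity (suc j) with label (u-edge j)
      ... | p , step-p = begin
        parity (f (u (suc j)))            ≡⟨ cong parity step-p ⟩
        parity (flip p (f (u j)))         ≡⟨ parity-flip p (f (u j)) ⟩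
        not (parity (f (u j)))            ≡⟨ cong not (u-parity j) ⟩
        not (parity (f u0) xor odd j)     ≡⟨ not-distribʳ-xor (parity (f u0)) (odd j) ⟩
        parity (f u0) xor odd (suc j)     ∎
        where open ≡-Reasoning

      closed-even : ∀ k → u k ≡ u 0 → odd k ≡ false
      closed-even k closes = xor-fixes (parity (f u0)) (odd k) (trans (sym (u-parity k)) (cong (parity ∘ f) closes))

      -- the first repetition u l ≡ u k has l = 0: otherwise u (k-1) would be a third
      -- rail neighbour of u l besides u (l-1) and u (l+1)
      no-inner-return : ∀ k l → suc l < k → u (suc l) ≡ u k → InjectiveBelow u k → ⊥
      no-inner-return (suc k') l (s≤s l<k') e injective
        with rails-among (adj-sym (u-edge l)) (not-rung-sym (u-rail l)) (u-edge (suc l)) (u-rail (suc l))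
                         (u-turns l ∘ sym) back-edge back-rail
        where
        back-edge : Adj G (u (suc l)) (u k')
        back-edge = subst (λ z → Adj G z (u k')) (sym e) (adj-sym (u-edge k'))
        back-rail : u k' ≢ r (u (suc l))
        back-rail = subst (λ z → u k' ≢ r z) (sym e) (not-rung-sym (u-rail k'))
      ... | inj₁ k'≡l = injective l k' l<k' (n<1+n k') (sym k'≡l)
      ... | inj₂ k'≡l+2 with <-cmp (suc (suc l)) k'
      ... | tri< l+2<k' _ _       = injective (suc (suc l)) k' l+2<k' (n<1+n k') (sym k'≡l+2)
      ... | tri≈ _ refl _         = u-turns (suc l) (sym e)
      ... | tri> _ _ (s≤s k'≤l+1) = adj-irrefl (u-edge k') (trans (cong u (≤-antisym k'≤l+1 l<k')) e)

      closing : Σ ℕ λ k → 3 ≤ k × u k ≡ u 0 × InjectiveBelow u k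
      closing with first-repetition u
      ... | k , suc l , l<k , e , injective = ⊥-elim (no-inner-return k l l<k e injective)
      ... | suc zero , zero , _ , e , _ = ⊥-elim (adj-irrefl (u-edge 0) e)
      ... | suc (suc zero) , zero , _ , e , _ = ⊥-elim (u-turns 0 (sym e))
      ... | suc (suc (suc k)) , zero , _ , e , injective = suc (suc (suc k)) , s≤s (s≤s (s≤s z≤n)) , sym e , injective

      module Closed (k : ℕ) (3≤k : 3 ≤ k) (closes : u k ≡ u 0) (injective : InjectiveBelow u k) where

        next : ℕ → ℕ
        next = nextℕ k

        u-next : ∀ t → u (next t) ≡ u (suc t)
        u-next t with next-cases k t
        ... | inj₁ (1+t≡k , e) = trans (cong u e) (trans (sym closes) (cong u (sym 1+t≡k)))
        ... | inj₂ (_ , e)     = cong u e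

        next-edge : ∀ t → Adj G (u t) (u (next t))
        next-edge t = subst (Adj G (u t)) (sym (u-next t)) (u-edge t)

        next-rail : ∀ t → u (next t) ≢ r (u t)
        next-rail t = subst (_≢ r (u t)) (sym (u-next t)) (u-rail t)

        u-injective : ∀ {a b} → a < k → b < k → u a ≡ u b → a ≡ b
        u-injective {a} {b} a<k b<k e with <-cmp a b
        ... | tri< a<b _ _ = ⊥-elim (injective a b a<b b<k e)
        ... | tri≈ _ a≡b _ = a≡b
        ... | tri> _ _ b<a = ⊥-elim (injective b a b<a a<k (sym e))

        -- the walk vertices after and before u t are distinct (this needs k ≥ 3)
        ahead≢behind : ∀ {t p} → p < k → next p ≡ t → u (suc t) ≢ u p
        ahead≢behind {zero} {p} p<k e with next-cases k p
        ... | inj₂ (_ , e')     = ⊥-elim (1+n≢0 (trans (sym e') e))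
        ... | inj₁ (1+p≡k , _)  = injective 1 p (1<p 3≤k 1+p≡k) p<k
          where 1<p : ∀ {p k} → 3 ≤ k → suc p ≡ k → 1 < p
                1<p {suc (suc p)} _ _ = s≤s (s≤s z≤n)
                1<p {zero}     (s≤s ())           refl
                1<p {suc zero} (s≤s (s≤s ()))     refl
        ahead≢behind {suc t} {p} p<k e with next-cases k p
        ... | inj₁ (_ , e')     = ⊥-elim (0≢1+n (trans (sym e') e))
        ... | inj₂ (_ , e')     = λ eq → u-turns t (trans eq (cong u (suc-injective (trans (sym e') e))))

        rail-neighbours : ∀ {t y} → t < k → Adj G (u t) y → y ≢ r (u t)
                        → y ≡ u (next t) ⊎ Σ ℕ λ p → p < k × next p ≡ t × y ≡ u p
        rail-neighbours {t} t<k ty y≢r with next-predecessor t<k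
        ... | p , p<k , next-p≡t with
              rails-among (next-edge t) (next-rail t) behind-edge behind-rail ahead≢ ty y≢r
          where
          behind-edge : Adj G (u t) (u p)
          behind-edge = adj-sym (subst (λ s → Adj G (u p) (u s)) next-p≡t (next-edge p))
          behind-rail : u p ≢ r (u t)
          behind-rail = not-rung-sym (subst (λ s → u s ≢ r (u p)) next-p≡t (next-rail p))
          ahead≢ : u (next t) ≢ u p
          ahead≢ e = ahead≢behind p<k next-p≡t (trans (sym (u-next t)) e)
        ... | inj₁ y≡ahead  = inj₁ y≡ahead
        ... | inj₂ y≡behind = inj₂ (p , p<k , next-p≡t , y≡behind)

        Covered : Fin n → Set
        Covered z = Σ ℕ λ t → t < k × (u t ≡ z ⊎ r (u t) ≡ z)

        covered-step : ∀ {z z'} → Covered z → Adj G z z' → Covered z'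
        covered-step {z' = z'} (t , t<k , inj₁ refl) zz' with z' ≟ r (u t)
        ... | yes z'≡r = t , t<k , inj₂ (sym z'≡r)
        ... | no  z'≢r with rail-neighbours t<k zz' z'≢r
        ... | inj₁ e                 = next t , next-< t<k , inj₁ (sym e)
        ... | inj₂ (p , p<k , _ , e) = p , p<k , inj₁ (sym e)
        covered-step {z' = z'} (t , t<k , inj₂ refl) zz' with r z' ≟ r (u t)
        ... | yes rz'≡r = t , t<k , inj₁ (sym (r-injective rz'≡r))
        ... | no  rz'≢r with rail-neighbours t<k (subst (λ w → Adj G w (r z')) r-involutive (r-automorphism zz')) rz'≢r
        ... | inj₁ e                 = next t , next-< t<k , inj₂ (trans (cong r (sym e)) r-involutive)
        ... | inj₂ (p , p<k , _ , e) = p , p<k , inj₂ (trans (cong r (sym e)) r-involutive)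

        covered-walk : ∀ {z z' m} → Walk G z z' m → Covered z → Covered z'
        covered-walk here        c = c
        covered-walk (step zz' w) c = covered-walk w (covered-step c zz')

        covered : ∀ z → Covered z
        covered z = covered-walk (proj₂ (connected (u 0) z)) (0 , ≤-trans (s≤s z≤n) 3≤k , inj₁ refl)

        layer-vertex : Fin 2 × Fin k → Fin n
        layer-vertex (fz    , t) = u (toℕ t)
        layer-vertex (fs fz , t) = r (u (toℕ t))

        coordinates : Fin n → Fin 2 × Fin k
        coordinates z with covered z
        ... | t , t<k , inj₁ _ = fz , fromℕ< t<k
        ... | t , t<k , inj₂ _ = fs fz , fromℕ< t<k

        vertex-coordinates : ∀ z → layer-vertex (coordinates z) ≡ z
        vertex-coordinates z with covered z
        ... | t , t<k , inj₁ e = trans (cong u (toℕ-fromℕ< t<k)) e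
        ... | t , t<k , inj₂ e = trans (cong (r ∘ u) (toℕ-fromℕ< t<k)) e

        position-injective : ∀ (x y : Fin k) → u (toℕ x) ≡ u (toℕ y) → x ≡ y
        position-injective x y e = toℕ-injective (u-injective (toℕ<n x) (toℕ<n y) e)

        fromℕ<-position : ∀ {t} (t<k : t < k) (x : Fin k) → u t ≡ u (toℕ x) → fromℕ< t<k ≡ x
        fromℕ<-position t<k x e = toℕ-injective (trans (toℕ-fromℕ< t<k) (u-injective t<k (toℕ<n x) e))

        coordinates-vertex : ∀ p → coordinates (layer-vertex p) ≡ p
        coordinates-vertex (fz , x) with covered (u (toℕ x))
        ... | t , t<k , inj₁ e = cong (fz ,_) (fromℕ<-position t<k x e)
        ... | t , t<k , inj₂ e = ⊥-elim (rung-off-walk t (toℕ x) e)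
        coordinates-vertex (fs fz , x) with covered (r (u (toℕ x)))
        ... | t , t<k , inj₁ e = ⊥-elim (rung-off-walk (toℕ x) t (sym e))
        ... | t , t<k , inj₂ e = cong (fs fz ,_) (fromℕ<-position t<k x (r-injective e))

        position-adj : ∀ (x y : Fin k) → Adj G (u (toℕ x)) (u (toℕ y)) ⇔ Adj (Cycle k) x y
        position-adj x y = ⇔-sym (cycle-adj k x y) ⇔-∘ mk⇔ forth back
          where
          forth : Adj G (u (toℕ x)) (u (toℕ y)) → toℕ y ≡ next (toℕ x) ⊎ toℕ x ≡ next (toℕ y)
          forth xy with rail-neighbours (toℕ<n x) xy (rung-off-walk (toℕ x) (toℕ y) ∘ sym)
          ... | inj₁ e = inj₁ (u-injective (toℕ<n y) (next-< (toℕ<n x)) e)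
          ... | inj₂ (p , p<k , next-p≡x , e) =
                inj₂ (trans (sym next-p≡x) (cong next (sym (u-injective (toℕ<n y) p<k e))))
          back : toℕ y ≡ next (toℕ x) ⊎ toℕ x ≡ next (toℕ y) → Adj G (u (toℕ x)) (u (toℕ y))
          back (inj₁ e) = subst (λ s → Adj G (u (toℕ x)) (u s)) (sym e) (next-edge (toℕ x))
          back (inj₂ e) = adj-sym (subst (λ s → Adj G (u (toℕ y)) (u s)) (sym e) (next-edge (toℕ y)))

        rung-adj : ∀ (x y : Fin k) → Adj G (u (toℕ x)) (r (u (toℕ y))) ⇔ x ≡ y
        rung-adj x y = mk⇔ forth (λ { refl → r-adj })
          where
          forth : Adj G (u (toℕ x)) (r (u (toℕ y))) → x ≡ y
          forth h = sym (position-injective y x (r-injective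
                      (side-change h (λ e → rung-off-walk (toℕ y) (toℕ x) (side-equal e)))))
            where
            side-equal : side (r (u (toℕ y))) ≡ side (u (toℕ x)) → r (u (toℕ y)) ≡ u (toℕ x)
            side-equal e = ⊥-elim (not-no-fixpoint (side (u (toℕ y)))
                             (trans (sym side-r) (trans e (trans (u-side (toℕ x)) (sym (u-side (toℕ y)))))))

        layer-adj : ∀ p q → Adj G (layer-vertex p) (layer-vertex q) ⇔ Adj (K2 □ Cycle k) p q
        layer-adj (fz , x)    (fz , y)    = ⇔-sym (prism-adj-layer (Cycle k) fz x y) ⇔-∘ position-adj x y
        layer-adj (fs fz , x) (fs fz , y) =
          ⇔-sym (prism-adj-layer (Cycle k) (fs fz) x y) ⇔-∘ (position-adj x y ⇔-∘ mk⇔ r-automorphism⁻ r-automorphism)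
        layer-adj (fz , x)    (fs fz , y) = ⇔-sym (prism-adj-rung (Cycle k) {fz} {fs fz} x y (λ ())) ⇔-∘ rung-adj x y
        layer-adj (fs fz , x) (fz , y)    =
          ⇔-sym (prism-adj-rung (Cycle k) {fs fz} {fz} x y (λ ())) ⇔-∘ (mk⇔ sym sym ⇔-∘ (rung-adj y x ⇔-∘ mk⇔ adj-sym adj-sym))

        prism-iso : Iso G (K2 □ Cycle k)
        prism-iso = iso-of-bijection G (K2 □ Cycle k) coordinates layer-vertex
                      vertex-coordinates coordinates-vertex layer-adj

      prism : Σ ℕ λ m → 2 ≤ m × Iso G (K2 □ Cycle (2 * m))
      prism with closing
      ... | k , 3≤k , closes , injective with even-half k (closed-even k closes)
      ... | m , k≡2m = m , half-≥2 (subst (3 ≤_) k≡2m 3≤k) ,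
                       subst (λ K → Iso G (K2 □ Cycle K)) k≡2m (Closed.prism-iso k 3≤k closes injective)

  prism-of-hub : VertexTransitive G → ∀ {v} → Hub v → Σ ℕ λ m → 2 ≤ m × Iso G (K2 □ Cycle (2 * m))
  prism-of-hub vt {v} hub@(e , ve , cosquares) = RailWalk.prism v
    where
    i : Fin d
    i = proj₁ (label ve)
    open Propagation (transport-hub vt hub) (transport-allCoSquare vt) i
    open Rungs i (hubRung-everywhere (e , proj₂ (label ve) , ve , cosquares))

lemma3p1 : (n : ℕ) (G : Graph (Fin n)) → IsSimple G → Cubic G → VertexTransitive G → PartialCube G
    → (Σ (Fin n) λ v → Σ (FourCycle G) λ C → Σ (FourCycle G) λ D → OnCycle v C × OnCycle v D × DistinctCycles C D)
    → Σ ℕ λ m → 2 ≤ m × Iso G (K2 □ Cycle (2 * m))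
lemma3p1 n G simple cubic vt partial (v , C , D , v∈C , v∈D , distinct) =
  prism-of-hub vt (distinct-squares-hub (fourCycle-at C v∈C) (fourCycle-at D v∈D) distinct)
  where open Prism G simple cubic (partialCube-embedding G partial)
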